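{- Let $\mathsf{e}$ be a potential event. (1) If $\mathbb{P}[\mathsf{e}]>0$, then there exists $n\in\mathbb{N}^{+}$ with $\mathsf{e}(n)=1$. (2) If $\mathsf{e}(n)=0$ for all $n\in\mathbb{N}^{+}$, then $\mathbb{P}[\mathsf{e}]=_{\mathbb{R}}0$.
   Context: Constructive setting. A potential event is a sequence $\mathsf{e}:\mathbb{N}^{+}\to\{0,1\}$. Define $\Phi(\mathsf{e})(n)=\frac{\sum_{i=1}^{n}\mathsf{e}(i)}{n}$. An actual event is a pair $(\mathsf{e},\gamma)$ with $\gamma:\mathbb{N}^{+}\to\mathbb{N}^{+}$ strictly increasing and $|\Phi(\mathsf{e})(\gamma(n)+i)-\Phi(\mathsf{e})(\gamma(n)+j)|\le\frac1n$ for all $n\in\mathbb{N}^{+}$, $i,j\in\mathbb{N}$; $\mathbb{P}(\mathsf{e},\gamma):=\Phi(\mathsf{e})\circ\gamma$, a Bishop real (sequence $x:\mathbb{N}^{+}\to\mathbb{Q}$ with $|x(n)-x(m)|\le\frac1n+\frac1m$). Write $\mathsf{e}\,\varepsilon\,\mathcal{A}$ for "there is $\gamma$ with $(\mathsf{e},\gamma)$ an actual event". For a property $\varphi(x)$ of reals, $\varphi(\mathbb{P}[\mathsf{e}])$ abbreviates: $\mathsf{e}\,\varepsilon\,\mathcal{A}$ and for every $\gamma$ with $(\mathsf{e},\gamma)$ an actual event, $\varphi(\mathbb{P}(\mathsf{e},\gamma))$. For Bishop reals, $x=_{\mathbb{R}}0$ iff $|x(n)|\le\frac2n$ for all $n$,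 and $x>0$ iff there is $n\in\mathbb{N}^{+}$ with $x(n)>\frac1n$. -}

module Defs where

open import Data.Nat as ℕ using (ℕ; zero; suc)
open import Data.Integer as ℤ using (ℤ)
open import Data.Rational as ℚ using (ℚ; _/_; _≤_; _<_; _-_; ∣_∣)
open import Data.Product using (Σ; ∃; _×_; _,_)
open import Relation.Binary.PropositionalEquality using (_≡_)

ℕ⁺ : Set
ℕ⁺ = Σ ℕ ℕ.NonZero

val : ℕ⁺ → ℕ
val (n , _) = n

_+⁺_ : ℕ⁺ → ℕ → ℕ⁺
(suc n , _) +⁺ i = (suc (n ℕ.+ i) , _)

1/⁺ : ℕ⁺ → ℚ
1/⁺ (suc n , _) = ℤ.+ 1 / suc n

2/⁺ : ℕ⁺ → ℚ
2/⁺ (suc n , _) = ℤ.+ 2 / suc n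

data Bit : Set where
  b0 b1 : Bit

bitℕ : Bit → ℕ
bitℕ b0 = 0
bitℕ b1 = 1

PotentialEvent : Set
PotentialEvent = ℕ⁺ → Bit

countUpTo : PotentialEvent → ℕ → ℕ
countUpTo e zero = 0
countUpTo e (suc n) = countUpTo e n ℕ.+ bitℕ (e (suc n , _))

Φ : PotentialEvent → ℕ⁺ → ℚ
Φ e (suc n , _) = ℤ.+ (countUpTo e (suc n)) / suc n

IsBishopReal : (ℕ⁺ → ℚ) → Set
IsBishopReal x = ∀ n m → ∣ x n - x m ∣ ≤ 1/⁺ n ℚ.+ 1/⁺ m

StrictlyIncreasing : (ℕ⁺ → ℕ⁺) → Set
StrictlyIncreasing γ = ∀ n m → val n ℕ.< val m → val (γ n) ℕ.< val (γ m)

IsActualEvent : PotentialEvent → (ℕ⁺ → ℕ⁺) → Set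
IsActualEvent e γ =
  StrictlyIncreasing γ ×
  (∀ (n : ℕ⁺) (i j : ℕ) → ∣ Φ e (γ n +⁺ i) - Φ e (γ n +⁺ j) ∣ ≤ 1/⁺ n)

ℙ : PotentialEvent → (ℕ⁺ → ℕ⁺) → (ℕ⁺ → ℚ)
ℙ e γ n = Φ e (γ n)

_ε𝒜 : PotentialEvent → Set
e ε𝒜 = ∃ λ γ → IsActualEvent e γ

-- φ(ℙ[e]) for a property φ of reals
Holds : ((ℕ⁺ → ℚ) → Set) → PotentialEvent → Set
Holds φ e = (e ε𝒜) × (∀ γ → IsActualEvent e γ → φ (ℙ e γ))

_=ℝ0 : (ℕ⁺ → ℚ) → Set
x =ℝ0 = ∀ n → ∣ x n ∣ ≤ 2/⁺ n

_>ℝ0 : (ℕ⁺ → ℚ) → Set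
x >ℝ0 = ∃ λ n → 1/⁺ n < x n

-- An event that never occurs has all frequencies Φ e n equal to 0; such a
-- sequence is trivially Cauchy (take γ = id), and every probability of it is
-- identically 0. Conversely, a positive frequency needs a positive count,
-- and a positive count of a finite prefix exhibits an occurrence.
module Submission where

open import Defs
open import Data.Nat as ℕ using (ℕ; zero; suc)
import Data.Nat.Properties as ℕP
open import Data.Integer as ℤ using ()
open import Data.Rational as ℚ using (ℚ; 0ℚ)
import Data.Rational.Properties as ℚP
open import Data.Product using (_×_; ∃; _,_)
open import Relation.Binary.PropositionalEquality using (_≡_; _≢_; refl; trans; subst)
open import Relation.Nullary using (contradiction)

1/⁺-positive : ∀ n → 0ℚ ℚ.< 1/⁺ n
1/⁺-positive (suc n , _) = ℚP.positive⁻¹ _ {{ℚP.normalize-pos 1 (suc n)}}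

2/⁺-nonNegative : ∀ n → 0ℚ ℚ.≤ 2/⁺ n
2/⁺-nonNegative (suc n , _) = ℚP.nonNegative⁻¹ _ {{ℚP.normalize-nonNeg 2 (suc n)}}

countUpTo≢0⇒occurs : ∀ e k → countUpTo e k ≢ 0 → ∃ λ n → e n ≡ b1
countUpTo≢0⇒occurs e zero count≢0 = contradiction refl count≢0
countUpTo≢0⇒occurs e (suc k) count≢0 with e (suc k , _) in eₖ
... | b1 = (suc k , _) , eₖ
... | b0 = countUpTo≢0⇒occurs e k
             (λ count≡0 → count≢0 (trans (ℕP.+-identityʳ _) count≡0))

Φ-positive⇒occurs : ∀ e m → 0ℚ ℚ.< Φ e m → ∃ λ n → e n ≡ b1
Φ-positive⇒occurs e (suc k , _) 0<Φ = countUpTo≢0⇒occurs e (suc k) count≢0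
  where
  count≢0 : countUpTo e (suc k) ≢ 0
  count≢0 count≡0 = ℚP.<-irrefl refl
    (subst (0ℚ ℚ.<_) (ℚP.0/n≡0 (suc k))
      (subst (λ c → 0ℚ ℚ.< ℤ.+ c ℚ./ suc k) count≡0 0<Φ))

Holds->ℝ0⇒occurs : ∀ e → Holds _>ℝ0 e → ∃ λ n → e n ≡ b1
Holds->ℝ0⇒occurs e ((γ , actual) , ℙ>0) with ℙ>0 γ actual
... | n , 1/n<ℙ = Φ-positive⇒occurs e (γ n)
                    (ℚP.<-trans (1/⁺-positive n) 1/n<ℙ)

module _ (e : PotentialEvent) (never : ∀ n → e n ≡ b0) where

  countUpTo-never : ∀ k → countUpTo e k ≡ 0
  countUpTo-never zero = refl
  countUpTo-never (suc k) rewrite countUpTo-never k | never (suc k , _) = refl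

  Φ-never : ∀ m → Φ e m ≡ 0ℚ
  Φ-never (suc k , _) rewrite countUpTo-never (suc k) = ℚP.0/n≡0 (suc k)

  id-isActualEvent : IsActualEvent e (λ n → n)
  id-isActualEvent = (λ _ _ n<m → n<m) , oscillation≤1/n
    where
    oscillation≤1/n : ∀ n i j → ℚ.∣ Φ e (n +⁺ i) ℚ.- Φ e (n +⁺ j) ∣ ℚ.≤ 1/⁺ n
    oscillation≤1/n n i j rewrite Φ-never (n +⁺ i) | Φ-never (n +⁺ j) =
      ℚP.<⇒≤ (1/⁺-positive n)

  ℙ-never : ∀ γ → ℙ e γ =ℝ0
  ℙ-never γ n rewrite Φ-never (γ n) = 2/⁺-nonNegative n

mainTheorem14 : (e : PotentialEvent) →
    (Holds _>ℝ0 e → ∃ λ n → e n ≡ b1) ×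
    ((∀ n → e n ≡ b0) → Holds _=ℝ0 e)
mainTheorem14 e =
  Holds->ℝ0⇒occurs e ,
  λ never → ((λ n → n) , id-isActualEvent e never) , λ γ _ → ℙ-never e never γ
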